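{- Let $A=(Q,q_0,\Sigma,\delta,\alpha)$ be a limit-deterministic Büchi automaton with deterministic trap $Q_d$ and let ${\sf Ord}$ be an ordering of the states of $A$ with respect to $Q_d$. Let $B=(Q^B,q^B_0,\Sigma,\delta^B,p)$ be the deterministic parity automaton constructed from $A$ and ${\sf Ord}$ as described in the context. Then $\mathsf L(A)=\mathsf L(B)$.
   Context: A (transition-based) Büchi automaton is $A=(Q,q_0,\Sigma,\delta,\alpha)$ with $Q$ finite, $q_0\in Q$, $\Sigma$ finite, $\delta\subseteq Q\times\Sigma\times Q$ total, $\alpha\subseteq\delta$; a run on $w$ is $\rho$ with $\rho(0)=q_0$, $(\rho(i),w(i),\rho(i+1))\in\delta$; accepting if infinitely many of these transitions lie in $\alpha$; $\mathsf L(A)$ = words having an accepting run. $A$ is limit-deterministic (LDBA) w.r.t. $Q_d\subseteq Q$ if $\alpha\subseteq Q_d\times\Sigma\times Q_d$, every $q\in Q_d$ has exactly one $\sigma$-successor $\delta(q,\sigma)$ for each $\sigma$, and it lies in $Q_d$; and $q_0\notin Q_d$. Let $\overline{Q_d}=Q\setminus Q_d$ and ${\sf post}^\sigma_\delta(S)=\{q'\mid\exists q\in S:(q,\sigma,q')\in\delta\}$. An ordering w.r.t. $Q_d$ is ${\sf Ord}:Q\to\{1,\dots,|Q_d|,+\infty\}$, $+\infty$ exactly on $\overline{Q_d}$ and injective on $Q_d$. A deterministic parity automaton (DPA) $(Q^B,q^B_0,\Sigma,\delta^B,p)$ has a transition function $\delta^B:Q^B\times\Sigma\to Q^B$ and a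 coloring $p$ assigning a positive integer to each transition; a word is accepted iff on its unique run the minimal color occurring infinitely often is even. Construction of $B$: For a totally ordered finite set $(t,<)$ and $e\in t$, ${\sf Ind}_{(t,<)}(e)$ is the position of $e$ in $t$ ($<$-minimum has index 1). $Q^B$ is the set of pairs $(s,(t,<))$ with $s\subseteq\overline{Q_d}$, $t\subseteq Q_d$ and $<$ a strict total order on $t$; $q^B_0=(\{q_0\},(\emptyset,\emptyset))$. For $\sigma\in\Sigma$, $\delta^B((s_1,(t_1,<_1)),\sigma)=(s_2,(t_2,<_2))$ where $s_2={\sf post}^\sigma_\delta(s_1)\cap\overline{Q_d}$, $t_2={\sf post}^\sigma_\delta(s_1\cup t_1)\cap Q_d$, and for $q_1,q_2\in t_2$, $q_1<_2q_2$ iff either (a) neither $q_1$ nor $q_2$ equals $\delta(q',\sigma)$ for some $q'\in t_1$, and ${\sf Ord}(q_1)<{\sf Ord}(q_2)$; or (b) $q_1=\delta(q'_1,\sigma)$ for some $q'_1\in t_1$ but $q_2$ is not of the form $\delta(q',\sigma)$ with $q'\in t_1$; or (c) both have such predecessors in $t_1$ and $\min_{<_1}\{q'\in t_1\mid \delta(q',\sigma)=q_1\}<_1\min_{<_1}\{q'\in t_1\mid\delta(q',\sigma)=q_2\}$. Coloring of this transition: let ${\sf Dec}(t_1)=\{q\in t_1\mid {\sf Ind}_{(t_2,<_2)}(\delta(q,\sigma))<{\sf Ind}_{(t_1,<_1)}(q)\}$ and ${\sf Acc}(t_1)=\{q\in t_1\mid\exists q'\in t_2:(q,\sigma,q')\in\alpha\}$.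 If ${\sf Dec}(t_1)=\emptyset\ne{\sf Acc}(t_1)$ the color is $2\min_{q\in{\sf Acc}(t_1)}{\sf Ind}_{(t_1,<_1)}(q)$; if ${\sf Acc}(t_1)=\emptyset\ne{\sf Dec}(t_1)$ it is $2\min_{q\in{\sf Dec}(t_1)}{\sf Ind}_{(t_1,<_1)}(q)-1$; if both are nonempty it is the minimum of these two values; if both are empty it is $2|Q_d|+1$. -}

module Defs where

open import Data.Bool using (Bool; true; false; _∧_; _∨_; not; if_then_else_)
open import Data.Nat using (ℕ; zero; suc; _+_; _*_; _∸_; _≤_; _<_; _<ᵇ_; _⊓_)
open import Data.Nat.Divisibility using (_∣_)
open import Data.Fin using (Fin)
open import Data.Fin.Properties using (_≟_)
open import Data.List using (List; []; _∷_; foldr; map)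
open import Data.List using (allFin)
open import Data.Maybe using (Maybe; just; nothing)
open import Data.Product using (Σ; ∃; ∃-syntax; _×_; _,_)
open import Relation.Nullary using (¬_; does)
open import Relation.Binary.PropositionalEquality using (_≡_)

Subset : ℕ → Set
Subset n = Fin n → Bool

anyF : ∀ {n} → (Fin n → Bool) → Bool
anyF {n} P = foldr (λ x b → P x ∨ b) false (allFin n)

allF : ∀ {n} → (Fin n → Bool) → Bool
allF {n} P = foldr (λ x b → P x ∧ b) true (allFin n)

countF : ∀ {n} → (Fin n → Bool) → ℕ
countF {n} P = foldr (λ x c → if P x then suc c else c) 0 (allFin n)

_⇒ᵇ_ : Bool → Bool → Bool
a ⇒ᵇ b = not a ∨ b

eqᵇ : ∀ {n} → Fin n → Fin n → Bool
eqᵇ x y = does (x ≟ y)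

minMaybe : Maybe ℕ → ℕ → Maybe ℕ
minMaybe nothing  v = just v
minMaybe (just m) v = just (m ⊓ v)

minValF : ∀ {n} → Subset n → (Fin n → ℕ) → Maybe ℕ
minValF {n} S f = foldr (λ x r → if S x then minMaybe r (f x) else r) nothing (allFin n)

minBy : ∀ {n} → (Fin n → Fin n → Bool) → Subset n → Maybe (Fin n)
minBy {n} lt S = foldr step nothing (allFin n)
  where
  isMin : Fin n → Bool
  isMin x = S x ∧ allF (λ y → S y ⇒ᵇ (eqᵇ y x ∨ lt x y))
  step : Fin n → Maybe (Fin n) → Maybe (Fin n)
  step x r = if isMin x then just x else r

-- Ind_{(t,<)}(e) : position of e in the ordered set (t,<), minimum has index 1
Ind : ∀ {n} → Subset n → (Fin n → Fin n → Bool) → Fin n → ℕ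
Ind t lt e = suc (countF (λ x → t x ∧ lt x e))

-- Transition-based Büchi automata over Q = Fin n, Σ = Fin k.

record Buchi (n k : ℕ) : Set where
  field
    q₀ : Fin n
    δ  : Fin n → Fin k → Fin n → Bool
    α  : Fin n → Fin k → Fin n → Bool

Word : ℕ → Set
Word k = ℕ → Fin k

module _ {n k : ℕ} (A : Buchi n k) where
  open Buchi A

  IsRun : Word k → (ℕ → Fin n) → Set
  IsRun w ρ = (ρ 0 ≡ q₀) × (∀ i → δ (ρ i) (w i) (ρ (suc i)) ≡ true)

  IsAcceptingRun : Word k → (ℕ → Fin n) → Set
  IsAcceptingRun w ρ = ∀ N → ∃[ i ] (N ≤ i × α (ρ i) (w i) (ρ (suc i)) ≡ true)

  AcceptsB : Word k → Set
  AcceptsB w = ∃[ ρ ] (IsRun w ρ × IsAcceptingRun w ρ)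

  IsBuchi : Set
  IsBuchi = (∀ q σ → ∃[ q' ] (δ q σ q' ≡ true))
          × (∀ q σ q' → α q σ q' ≡ true → δ q σ q' ≡ true)

  IsLimitDet : Subset n → Set
  IsLimitDet Qd =
      (∀ q σ q' → α q σ q' ≡ true → (Qd q ≡ true × Qd q' ≡ true))
    × (∀ q → Qd q ≡ true → ∀ σ → ∃[ q' ] (δ q σ q' ≡ true × Qd q' ≡ true
                                  × (∀ q'' → δ q σ q'' ≡ true → q'' ≡ q')))
    × (Qd q₀ ≡ false)

-- ℕ ∪ {+∞}: nothing = +∞
ℕ∞ : Set
ℕ∞ = Maybe ℕ

_<∞_ : ℕ∞ → ℕ∞ → Bool
just a  <∞ just b  = a <ᵇ b
just _  <∞ nothing = true
nothing <∞ _       = false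

IsOrdering : ∀ {n} → Subset n → (Fin n → ℕ∞) → Set
IsOrdering {n} Qd Ord =
    (∀ q → Qd q ≡ false → Ord q ≡ nothing)
  × (∀ q → Qd q ≡ true → ∃[ m ] (Ord q ≡ just m × 1 ≤ m × m ≤ countF Qd))
  × (∀ q₁ q₂ → Qd q₁ ≡ true → Qd q₂ ≡ true → Ord q₁ ≡ Ord q₂ → q₁ ≡ q₂)

record DPA (k : ℕ) : Set₁ where
  field
    State : Set
    init  : State
    trans : State → Fin k → State
    color : State → Fin k → ℕ

module _ {k : ℕ} (B : DPA k) where
  open DPA B

  runD : Word k → ℕ → State
  runD w zero    = init
  runD w (suc i) = trans (runD w i) (w i)

  colorAt : Word k → ℕ → ℕ
  colorAt w i = color (runD w i) (w i)

  InfOften : Word k → ℕ → Set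
  InfOften w c = ∀ N → ∃[ i ] (N ≤ i × colorAt w i ≡ c)

  AcceptsD : Word k → Set
  AcceptsD w = ∃[ c ] (InfOften w c × (2 ∣ c) × (∀ c' → c' < c → ¬ InfOften w c'))

-- The construction of B from A and Ord.
-- A state (s,(t,<)) is represented by s t : Subset n and < as a Boolean
-- relation on Fin n (meaningful on t).

record BState (n : ℕ) : Set where
  constructor ⟨_,_,_⟩
  field
    s  : Subset n
    t  : Subset n
    lt : Fin n → Fin n → Bool

module Construction {n k : ℕ} (A : Buchi n k) (Qd : Subset n) (Ord : Fin n → ℕ∞) where
  open Buchi A

  post : Fin k → Subset n → Subset n
  post σ S q' = anyF (λ q → S q ∧ δ q σ q')

  initB : BState n
  initB = ⟨ eqᵇ q₀ , (λ _ → false) , (λ _ _ → false) ⟩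

  hasPred : Subset n → Fin k → Fin n → Bool
  hasPred t₁ σ q = anyF (λ q' → t₁ q' ∧ δ q' σ q)

  transB : BState n → Fin k → BState n
  transB ⟨ s₁ , t₁ , lt₁ ⟩ σ = ⟨ s₂ , t₂ , lt₂ ⟩
    where
    s₂ : Subset n
    s₂ q = post σ s₁ q ∧ not (Qd q)
    t₂ : Subset n
    t₂ q = post σ (λ x → s₁ x ∨ t₁ x) q ∧ Qd q
    minPred : Fin n → Maybe (Fin n)
    minPred q = minBy lt₁ (λ q' → t₁ q' ∧ δ q' σ q)
    caseC : Fin n → Fin n → Bool
    caseC q₁ q₂ with minPred q₁ | minPred q₂
    ... | just m₁ | just m₂ = lt₁ m₁ m₂
    ... | _       | _       = false
    lt₂ : Fin n → Fin n → Bool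
    lt₂ q₁ q₂ = t₂ q₁ ∧ t₂ q₂ ∧
      (  (not (hasPred t₁ σ q₁) ∧ not (hasPred t₁ σ q₂) ∧ (Ord q₁ <∞ Ord q₂))
      ∨  (hasPred t₁ σ q₁ ∧ not (hasPred t₁ σ q₂))
      ∨  (hasPred t₁ σ q₁ ∧ hasPred t₁ σ q₂ ∧ caseC q₁ q₂))

  colorB : BState n → Fin k → ℕ
  colorB st σ = combine decMin accMin
    where
    open BState st renaming (s to s₁; t to t₁; lt to lt₁)
    st₂ : BState n
    st₂ = transB st σ
    t₂  = BState.t st₂
    lt₂ = BState.lt st₂
    isDec : Fin n → Bool
    isDec q = anyF (λ q' → δ q σ q' ∧ (Ind t₂ lt₂ q' <ᵇ Ind t₁ lt₁ q))
    isAcc : Fin n → Bool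
    isAcc q = anyF (λ q' → t₂ q' ∧ α q σ q')
    decMin : Maybe ℕ
    decMin = minValF (λ q → t₁ q ∧ isDec q) (Ind t₁ lt₁)
    accMin : Maybe ℕ
    accMin = minValF (λ q → t₁ q ∧ isAcc q) (Ind t₁ lt₁)
    combine : Maybe ℕ → Maybe ℕ → ℕ
    combine nothing  (just a) = 2 * a
    combine (just d) nothing  = 2 * d ∸ 1
    combine (just d) (just a) = (2 * a) ⊓ (2 * d ∸ 1)
    combine nothing  nothing  = 2 * countF Qd + 1

  B : DPA k
  B = record { State = BState n ; init = initB ; trans = transB ; color = colorB }

-- Along the run of B, a state q ∈ Q_d of the ordered set t has a position Ind q, and its
-- deterministic successor never gets a larger position. A transition of colour 2i−1 means that
-- some state of position ≤ i decreases, and then so do all states of larger position; colour 2i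
-- means that the state of position i takes an accepting transition and nothing at or below it
-- decreases.
-- (⊆) An accepting run of A eventually stays in Q_d, hence in t, and its position stabilises at
-- some m. From then on no odd colour below 2m occurs, while every accepting transition produces
-- a colour ≤ 2m, so the least colour occurring infinitely often is even.
-- (⊇) If 2j is that least colour, then eventually no colour below 2j occurs, so the state at
-- position j never decreases again. Reaching it through the subset part and then following
-- successors yields a run of A that is accepting whenever colour 2j recurs.
-- Excluded middle supplies the stabilisation point and the least recurring colour.

module Submission where

open import Defs
open import Axiom.ExcludedMiddle using (ExcludedMiddle)
open import Data.Bool using (Bool; true; false; _∧_; _∨_; not; if_then_else_; T)
import Data.Bool as Bool
open import Data.Bool.Properties using (∧-conicalˡ; ∧-conicalʳ; ∨-identityʳ; ¬-not; not-injective)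
open import Data.Fin using (Fin)
open import Data.Fin.Properties using (_≟_)
open import Data.List using (List; []; _∷_; foldr; allFin)
open import Data.List.Membership.Propositional using (_∈_)
open import Data.List.Membership.Propositional.Properties using (∈-allFin)
import Data.List.Relation.Unary.All as All
open import Data.List.Relation.Unary.Any using (here; there)
open import Data.List.Relation.Unary.AllPairs using (_∷_)
open import Data.List.Relation.Unary.Unique.Propositional using (Unique)
open import Data.List.Relation.Unary.Unique.Propositional.Properties using (allFin⁺)
open import Data.Maybe using (Maybe; just; nothing)
open import Data.Maybe.Properties using (just-injective)
open import Data.Nat using (ℕ; zero; suc; _+_; _*_; _∸_; _≤_; _<_; _<ᵇ_; _⊓_; _⊔_; z≤n; s≤s; _≤?_)
open import Data.Nat.Divisibility using (_∣_; m∣m*n)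
open import Data.Nat.Induction using (<-rec)
open import Data.Nat.Properties hiding (_≟_)
open import Data.Product using (∃-syntax; Σ-syntax; _×_; _,_; proj₁; proj₂)
open import Data.Sum using (_⊎_; inj₁; inj₂; [_,_]′) renaming (map to ⊎-map)
open import Function using (_∘_)
open import Function.Bundles using (_⇔_; mk⇔)
open import Level using (0ℓ)
open import Relation.Nullary using (¬_; yes; no; contradiction)
open import Relation.Nullary.Decidable using (dec-true)
open import Relation.Binary.Definitions using (tri<; tri≈; tri>)
open import Relation.Binary.PropositionalEquality

∧-elimˡ : ∀ {a b} → a ∧ b ≡ true → a ≡ true
∧-elimˡ {a} {b} = ∧-conicalˡ a b

∧-elimʳ : ∀ {a b} → a ∧ b ≡ true → b ≡ true
∧-elimʳ {a} {b} = ∧-conicalʳ a b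

∧-intro : ∀ {a b} → a ≡ true → b ≡ true → a ∧ b ≡ true
∧-intro refl refl = refl

∨-elim : ∀ {a b} → a ∨ b ≡ true → a ≡ true ⊎ b ≡ true
∨-elim {true}  _ = inj₁ refl
∨-elim {false} p = inj₂ p

∨-introˡ : ∀ {a b} → a ≡ true → a ∨ b ≡ true
∨-introˡ refl = refl

∨-introʳ : ∀ {a b} → b ≡ true → a ∨ b ≡ true
∨-introʳ {true}  _ = refl
∨-introʳ {false} p = p

true≢false : ∀ {a} → a ≡ true → a ≢ false
true≢false refl ()

¬true⇒false : ∀ {a} → ¬ (a ≡ true) → a ≡ false
¬true⇒false = ¬-not

eqᵇ⇒≡ : ∀ {n} {x y : Fin n} → eqᵇ x y ≡ true → x ≡ y
eqᵇ⇒≡ {x = x} {y} p with x ≟ y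
... | yes x≡y = x≡y

eqᵇ-refl : ∀ {n} (x : Fin n) → eqᵇ x x ≡ true
eqᵇ-refl x = dec-true (x ≟ x) refl

T⇒≡true : ∀ {b} → T b → b ≡ true
T⇒≡true {true} _ = refl

≡true⇒T : ∀ {b} → b ≡ true → T b
≡true⇒T refl = _

module _ {A : Set} (P : A → Bool) where

  anyL : List A → Bool
  anyL = foldr (λ x b → P x ∨ b) false

  allL : List A → Bool
  allL = foldr (λ x b → P x ∧ b) true

  countL : List A → ℕ
  countL = foldr (λ x c → if P x then suc c else c) 0

  anyL-intro : ∀ {x xs} → x ∈ xs → P x ≡ true → anyL xs ≡ true
  anyL-intro (here refl) p = ∨-introˡ p
  anyL-intro {xs = y ∷ _} (there x∈) p = ∨-introʳ {P y} (anyL-intro x∈ p)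

  anyL-elim : ∀ xs → anyL xs ≡ true → ∃[ x ] (x ∈ xs × P x ≡ true)
  anyL-elim (y ∷ xs) p with ∨-elim {P y} p
  ... | inj₁ py = y , here refl , py
  ... | inj₂ q  = let (x , x∈ , px) = anyL-elim xs q in x , there x∈ , px

  allL-elim : ∀ {x xs} → allL xs ≡ true → x ∈ xs → P x ≡ true
  allL-elim p (here refl) = ∧-elimˡ p
  allL-elim {xs = y ∷ _} p (there x∈) = allL-elim (∧-elimʳ {P y} p) x∈

  allL-intro : ∀ xs → (∀ x → x ∈ xs → P x ≡ true) → allL xs ≡ true
  allL-intro []       h = refl
  allL-intro (x ∷ xs) h = ∧-intro (h x (here refl)) (allL-intro xs (λ y y∈ → h y (there y∈)))

module _ {A : Set} (P Q : A → Bool) (P⊆Q : ∀ x → P x ≡ true → Q x ≡ true) where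

  countL-mono : ∀ xs → countL P xs ≤ countL Q xs
  countL-mono []       = z≤n
  countL-mono (x ∷ xs) with P x in px | Q x in qx
  ... | true  | true  = s≤s (countL-mono xs)
  ... | true  | false = contradiction qx (true≢false (P⊆Q x px))
  ... | false | true  = m≤n⇒m≤1+n (countL-mono xs)
  ... | false | false = countL-mono xs

  countL-mono-< : ∀ {z xs} → z ∈ xs → Q z ≡ true → P z ≡ false → countL P xs < countL Q xs
  countL-mono-< {xs = _ ∷ xs} (here refl) qz pz rewrite qz | pz = s≤s (countL-mono xs)
  countL-mono-< {xs = x ∷ xs} (there z∈) qz pz with P x in px | Q x in qx
  ... | true  | true  = s≤s (countL-mono-< z∈ qz pz)
  ... | true  | false = contradiction qx (true≢false (P⊆Q x px))
  ... | false | true  = m≤n⇒m≤1+n (countL-mono-< z∈ qz pz)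
  ... | false | false = countL-mono-< z∈ qz pz

remove : ∀ {A : Set} {x : A} (ys : List A) → x ∈ ys → List A
remove (_ ∷ ys) (here _)   = ys
remove (y ∷ ys) (there x∈) = y ∷ remove ys x∈

∈-remove : ∀ {A : Set} {x y : A} {ys} (x∈ : x ∈ ys) → y ∈ ys → y ≢ x → y ∈ remove ys x∈
∈-remove (here refl) (here refl) y≢x = contradiction refl y≢x
∈-remove (here refl) (there y∈)  _   = y∈
∈-remove (there x∈)  (here refl) _   = here refl
∈-remove (there x∈)  (there y∈)  y≢x = there (∈-remove x∈ y∈ y≢x)

countL-remove : ∀ {A : Set} (Q : A → Bool) {x ys} (x∈ : x ∈ ys) → Q x ≡ true →
  countL Q ys ≡ suc (countL Q (remove ys x∈))
countL-remove Q (here refl) qx rewrite qx = refl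
countL-remove Q {ys = y ∷ _} (there x∈) qx with Q y
... | true  = cong suc (countL-remove Q x∈ qx)
... | false = countL-remove Q x∈ qx

countL-injection : ∀ {A : Set} (P Q : A → Bool) (h : A → A) xs ys → Unique xs →
  (∀ x → x ∈ xs → P x ≡ true → h x ∈ ys × Q (h x) ≡ true) →
  (∀ x y → x ∈ xs → y ∈ xs → P x ≡ true → P y ≡ true → h x ≡ h y → x ≡ y) →
  countL P xs ≤ countL Q ys
countL-injection P Q h []       ys _            _    _   = z≤n
countL-injection P Q h (x ∷ xs) ys (x∉xs ∷ uniq) into inj with P x in px
... | false = countL-injection P Q h xs ys uniq (λ z z∈ → into z (there z∈))
                (λ a b a∈ b∈ → inj a b (there a∈) (there b∈))
... | true with into x (here refl) px
...   | hx∈ , qhx = subst (suc (countL P xs) ≤_) (sym (countL-remove Q hx∈ qhx))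
    (s≤s (countL-injection P Q h xs (remove ys hx∈) uniq into′
           (λ a b a∈ b∈ → inj a b (there a∈) (there b∈))))
  where
  into′ : ∀ z → z ∈ xs → P z ≡ true → h z ∈ remove ys hx∈ × Q (h z) ≡ true
  into′ z z∈ pz = let (hz∈ , qhz) = into z (there z∈) pz in
    ∈-remove hx∈ hz∈ (λ hz≡hx → All.lookup x∉xs z∈ (sym (inj z x (there z∈) (here refl) pz px hz≡hx))) , qhz

module _ {n : ℕ} where

  anyF-intro : ∀ (P : Fin n → Bool) x → P x ≡ true → anyF P ≡ true
  anyF-intro P x = anyL-intro P (∈-allFin x)

  anyF-elim : ∀ (P : Fin n → Bool) → anyF P ≡ true → ∃[ x ] (P x ≡ true)
  anyF-elim P p = let (x , _ , px) = anyL-elim P (allFin n) p in x , px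

  anyF-false : ∀ (P : Fin n → Bool) → anyF P ≡ false → ∀ x → P x ≡ false
  anyF-false P none x = ¬true⇒false (λ px → true≢false (anyF-intro P x px) none)

  allF-elim : ∀ (P : Fin n → Bool) → allF P ≡ true → ∀ x → P x ≡ true
  allF-elim P p x = allL-elim P p (∈-allFin x)

  allF-intro : ∀ (P : Fin n → Bool) → (∀ x → P x ≡ true) → allF P ≡ true
  allF-intro P h = allL-intro P (allFin n) (λ x _ → h x)

  module _ (P Q : Fin n → Bool) (P⊆Q : ∀ x → P x ≡ true → Q x ≡ true) where

    countF-mono : countF P ≤ countF Q
    countF-mono = countL-mono P Q P⊆Q (allFin n)

    countF-mono-< : ∀ z → Q z ≡ true → P z ≡ false → countF P < countF Q
    countF-mono-< z = countL-mono-< P Q P⊆Q (∈-allFin z)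

  countF-injection : ∀ (P Q : Fin n → Bool) (h : Fin n → Fin n) →
    (∀ x → P x ≡ true → Q (h x) ≡ true) →
    (∀ x y → P x ≡ true → P y ≡ true → h x ≡ h y → x ≡ y) →
    countF P ≤ countF Q
  countF-injection P Q h into inj = countL-injection P Q h (allFin n) (allFin n) (allFin⁺ n)
    (λ x _ px → ∈-allFin (h x) , into x px) (λ x y _ _ → inj x y)

module _ {A : Set} (S : A → Bool) (f : A → ℕ) where

  minValL : List A → Maybe ℕ
  minValL = foldr (λ x r → if S x then minMaybe r (f x) else r) nothing

  minValL-attained : ∀ xs {d} → minValL xs ≡ just d → ∃[ x ] (S x ≡ true × f x ≡ d)
  minValL-attained (y ∷ xs) e with S y in sy
  ... | false = minValL-attained xs e
  ... | true with minValL xs in er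
  ...   | nothing = y , sy , just-injective e
  ...   | just m with ⊓-sel m (f y)
  ...     | inj₁ m⊓fy≡m = minValL-attained xs (trans er (cong just (trans (sym m⊓fy≡m) (just-injective e))))
  ...     | inj₂ m⊓fy≡fy = y , sy , trans (sym m⊓fy≡fy) (just-injective e)

  minValL-≤ : ∀ {x xs} → x ∈ xs → S x ≡ true → ∃[ d ] (minValL xs ≡ just d × d ≤ f x)
  minValL-≤ {xs = y ∷ xs} x∈ sx with S y in sy
  minValL-≤ (here refl) sx | false = contradiction sy (true≢false sx)
  minValL-≤ (there x∈)  sx | false = minValL-≤ x∈ sx
  minValL-≤ {xs = y ∷ xs} (here refl) sx | true with minValL xs
  ... | nothing = f y , refl , ≤-refl
  ... | just r  = r ⊓ f y , refl , m⊓n≤n r (f y)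
  minValL-≤ (there x∈) sx | true with minValL-≤ x∈ sx
  ... | d , e , d≤fx rewrite e = d ⊓ _ , refl , ≤-trans (m⊓n≤m d _) d≤fx

module _ {n : ℕ} (S : Subset n) (f : Fin n → ℕ) where

  minValF-attained : ∀ {d} → minValF S f ≡ just d → ∃[ x ] (S x ≡ true × f x ≡ d)
  minValF-attained = minValL-attained S f (allFin n)

  minValF-≤ : ∀ x → S x ≡ true → ∃[ d ] (minValF S f ≡ just d × d ≤ f x)
  minValF-≤ x = minValL-≤ S f (∈-allFin x)

module _ {A : Set} (p : A → Bool) where

  findL : List A → Maybe A
  findL = foldr (λ x r → if p x then just x else r) nothing

  findL-sound : ∀ xs {x} → findL xs ≡ just x → p x ≡ true
  findL-sound (y ∷ xs) e with p y in py
  ... | true  = subst (λ z → p z ≡ true) (just-injective e) py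
  ... | false = findL-sound xs e

  findL-complete : ∀ {x xs} → x ∈ xs → p x ≡ true → ∃[ y ] (findL xs ≡ just y)
  findL-complete {xs = y ∷ xs} x∈ px with p y in py
  ... | true = y , refl
  findL-complete (here refl) px | false = contradiction py (true≢false px)
  findL-complete (there x∈)  px | false = findL-complete x∈ px

-- Strict total orders on a finite subset, and the position Ind of an element

record IsStrictTotalOn {n} (t : Subset n) (lt : Fin n → Fin n → Bool) : Set where
  field
    lt-⊆      : ∀ x y → lt x y ≡ true → t x ≡ true × t y ≡ true
    lt-irrefl : ∀ x → ¬ (lt x x ≡ true)
    lt-trans  : ∀ x y z → lt x y ≡ true → lt y z ≡ true → lt x z ≡ true
    lt-tri    : ∀ x y → t x ≡ true → t y ≡ true → x ≡ y ⊎ lt x y ≡ true ⊎ lt y x ≡ true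

module _ {n} (lt : Fin n → Fin n → Bool) (S : Subset n) where

  IsLeast : Fin n → Set
  IsLeast m = S m ≡ true × (∀ y → S y ≡ true → y ≡ m ⊎ lt m y ≡ true)

  isLeastᵇ : Fin n → Bool
  isLeastᵇ x = S x ∧ allF (λ y → S y ⇒ᵇ (eqᵇ y x ∨ lt x y))

  minBy-least : ∀ {m} → minBy lt S ≡ just m → IsLeast m
  minBy-least {m} e = ∧-elimˡ least , λ y sy →
      [ inj₁ ∘ eqᵇ⇒≡ , inj₂ ]′ (∨-elim (subst (λ b → not b ∨ (eqᵇ y m ∨ lt m y) ≡ true) sy
                                           (allF-elim _ (∧-elimʳ {S m} least) y)))
    where
    least : isLeastᵇ m ≡ true
    least = findL-sound isLeastᵇ (allFin n) e

  isLeast⇒isLeastᵇ : ∀ {m} → IsLeast m → isLeastᵇ m ≡ true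
  isLeast⇒isLeastᵇ {m} (sm , least) = ∧-intro sm (allF-intro _ below)
    where
    below : ∀ y → (S y ⇒ᵇ (eqᵇ y m ∨ lt m y)) ≡ true
    below y with S y in sy
    ... | false = refl
    ... | true with least y sy
    ...   | inj₁ refl = ∨-introˡ (eqᵇ-refl y)
    ...   | inj₂ m<y  = ∨-introʳ {eqᵇ y m} m<y

  module _ {t : Subset n} (ord : IsStrictTotalOn t lt) (S⊆t : ∀ x → S x ≡ true → t x ≡ true) where
    open IsStrictTotalOn ord

    leastInList : ∀ xs → (∀ y → y ∈ xs → S y ≡ false)
                       ⊎ ∃[ m ] (S m ≡ true × (∀ y → y ∈ xs → S y ≡ true → y ≡ m ⊎ lt m y ≡ true))
    leastInList [] = inj₁ λ _ ()
    leastInList (x ∷ xs) with S x in sx | leastInList xs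
    ... | false | inj₁ none = inj₁ λ { _ (here refl) → sx ; y (there y∈) → none y y∈ }
    ... | false | inj₂ (m , sm , least) =
      inj₂ (m , sm , λ { _ (here refl) sy → contradiction sx (true≢false sy)
                       ; y (there y∈) sy → least y y∈ sy })
    ... | true | inj₁ none =
      inj₂ (x , sx , λ { _ (here refl) _ → inj₁ refl
                       ; y (there y∈) sy → contradiction (none y y∈) (true≢false sy) })
    ... | true | inj₂ (m , sm , least) with lt-tri x m (S⊆t x sx) (S⊆t m sm)
    ...   | inj₁ refl = inj₂ (m , sm , λ { _ (here refl) _ → inj₁ refl ; y (there y∈) sy → least y y∈ sy })
    ...   | inj₂ (inj₂ m<x) = inj₂ (m , sm , λ { _ (here refl) _ → inj₂ m<x ; y (there y∈) sy → least y y∈ sy })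
    ...   | inj₂ (inj₁ x<m) = inj₂ (x , sx , λ
            { _ (here refl) _ → inj₁ refl
            ; y (there y∈) sy → inj₂ ([ (λ { refl → x<m }) , lt-trans x m y x<m ]′ (least y y∈ sy)) })

    minBy-exists : ∀ x → S x ≡ true → ∃[ m ] (minBy lt S ≡ just m)
    minBy-exists x sx with leastInList (allFin n)
    ... | inj₁ none = contradiction (none x (∈-allFin x)) (true≢false sx)
    ... | inj₂ (m , sm , least) =
      findL-complete isLeastᵇ (∈-allFin m) (isLeast⇒isLeastᵇ (sm , λ y → least y (∈-allFin y)))

module Position {n} {t : Subset n} {lt : Fin n → Fin n → Bool} (ord : IsStrictTotalOn t lt) where
  open IsStrictTotalOn ord

  below : Fin n → Subset n
  below r z = t z ∧ lt z r

  below-irrefl : ∀ r → below r r ≡ false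
  below-irrefl r = ¬true⇒false (lt-irrefl r ∘ ∧-elimʳ {t r})

  Ind-mono-< : ∀ q r → lt q r ≡ true → Ind t lt q < Ind t lt r
  Ind-mono-< q r q<r = s≤s (countF-mono-< (below q) (below r)
    (λ z z<q → ∧-intro (∧-elimˡ z<q) (lt-trans z q r (∧-elimʳ {t z} z<q) q<r))
    q (∧-intro (proj₁ (lt-⊆ q r q<r)) q<r) (below-irrefl q))

  Ind-≤⇒≼ : ∀ q r → t q ≡ true → t r ≡ true → Ind t lt q ≤ Ind t lt r → q ≡ r ⊎ lt q r ≡ true
  Ind-≤⇒≼ q r tq tr Iq≤Ir with lt-tri q r tq tr
  ... | inj₁ q≡r        = inj₁ q≡r
  ... | inj₂ (inj₁ q<r) = inj₂ q<r
  ... | inj₂ (inj₂ r<q) = contradiction Iq≤Ir (<⇒≱ (Ind-mono-< r q r<q))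

  Ind-injective : ∀ q r → t q ≡ true → t r ≡ true → Ind t lt q ≡ Ind t lt r → q ≡ r
  Ind-injective q r tq tr Iq≡Ir with Ind-≤⇒≼ q r tq tr (≤-reflexive Iq≡Ir)
  ... | inj₁ q≡r = q≡r
  ... | inj₂ q<r = contradiction Iq≡Ir (<⇒≢ (Ind-mono-< q r q<r))

  Ind-≤-count : ∀ (U : Subset n) → (∀ x → t x ≡ true → U x ≡ true) →
    ∀ r → t r ≡ true → Ind t lt r ≤ countF U
  Ind-≤-count U t⊆U r tr = countF-mono-< (below r) U (λ z z<r → t⊆U z (∧-elimˡ z<r)) r (t⊆U r tr) (below-irrefl r)

-- Sequences over ℕ

Frequently : (ℕ → Set) → Set
Frequently P = ∀ N → ∃[ i ] (N ≤ i × P i)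

Eventually : (ℕ → Set) → Set
Eventually P = ∃[ N ] (∀ i → N ≤ i → P i)

induction-from : ∀ {P : ℕ → Set} N → P N → (∀ i → N ≤ i → P i → P (suc i)) → ∀ i → N ≤ i → P i
induction-from N pN step i N≤i with m≤n⇒m<n∨m≡n N≤i
induction-from N pN step (suc i) _ | inj₁ N<1+i = step i (≤-pred N<1+i) (induction-from N pN step i (≤-pred N<1+i))
induction-from N pN step i       _ | inj₂ refl  = pN

module Classical (em : ExcludedMiddle 0ℓ) where

  ¬frequently⇒eventually : ∀ {P : ℕ → Set} → ¬ Frequently P → Eventually (¬_ ∘ P)
  ¬frequently⇒eventually {P} ¬freq with em {Eventually (¬_ ∘ P)}
  ... | yes ev  = ev
  ... | no ¬ev = contradiction frequent ¬freq
    where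
    frequent : Frequently P
    frequent N with em {∃[ i ] (N ≤ i × P i)}
    ... | yes p  = p
    ... | no ¬p = contradiction (N , λ i N≤i pi → ¬p (i , N≤i , pi)) ¬ev

  module _ (col : ℕ → ℕ) where

    FrequentValue : ℕ → Set
    FrequentValue c = Frequently (λ i → col i ≡ c)

    IsLeastFrequentValue : ℕ → Set
    IsLeastFrequentValue c = FrequentValue c × (∀ c′ → c′ < c → ¬ FrequentValue c′)

    least-frequent-value : ∀ B → Frequently (λ i → col i ≤ B) → ∃[ c ] (c ≤ B × IsLeastFrequentValue c)
    least-frequent-value zero freq =
      0 , z≤n , (λ N → let (i , N≤i , ci≤0) = freq N in i , N≤i , n≤0⇒n≡0 ci≤0) , λ _ ()
    least-frequent-value (suc B) freq with em {Frequently (λ i → col i ≤ B)}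
    ... | yes freqB = let (c , c≤B , least) = least-frequent-value B freqB in c , m≤n⇒m≤1+n c≤B , least
    ... | no ¬freqB = suc B , ≤-refl , hits , λ c′ c′≤B freqc′ →
            let (i , N₀≤i , ci≡c′) = freqc′ N₀ in above i N₀≤i (subst (_≤ B) (sym ci≡c′) (≤-pred c′≤B))
      where
      N₀ : ℕ
      N₀ = proj₁ (¬frequently⇒eventually ¬freqB)
      above : ∀ i → N₀ ≤ i → ¬ (col i ≤ B)
      above = proj₂ (¬frequently⇒eventually ¬freqB)
      hits : FrequentValue (suc B)
      hits N = let (i , le , ci≤1+B) = freq (N ⊔ N₀) in
        i , ≤-trans (m≤m⊔n N N₀) le , ≤-antisym ci≤1+B (≰⇒> (above i (≤-trans (m≤n⊔m N N₀) le)))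

    eventually-≥ : ∀ B → (∀ c′ → c′ < B → ¬ FrequentValue c′) → Eventually (λ i → B ≤ col i)
    eventually-≥ zero    _    = 0 , λ _ _ → z≤n
    eventually-≥ (suc B) rare =
      N₁ ⊔ N₂ , λ i le → ≤∧≢⇒< (≥B i (≤-trans (m≤m⊔n N₁ N₂) le))
                                (≢B i (≤-trans (m≤n⊔m N₁ N₂) le) ∘ sym)
      where
      N₁ N₂ : ℕ
      N₁ = proj₁ (eventually-≥ B (λ c′ c′<B → rare c′ (m≤n⇒m≤1+n c′<B)))
      N₂ = proj₁ (¬frequently⇒eventually (rare B ≤-refl))
      ≥B : ∀ i → N₁ ≤ i → B ≤ col i
      ≥B = proj₂ (eventually-≥ B (λ c′ c′<B → rare c′ (m≤n⇒m≤1+n c′<B)))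
      ≢B : ∀ i → N₂ ≤ i → ¬ (col i ≡ B)
      ≢B = proj₂ (¬frequently⇒eventually (rare B ≤-refl))

  eventually-constant : ∀ (g : ℕ → ℕ) N → (∀ i → N ≤ i → g (suc i) ≤ g i) →
    ∃[ M ] (N ≤ M × (∀ i → M ≤ i → g i ≡ g M))
  eventually-constant g N₀ nonincreasing = <-rec Goal go (g N₀) N₀ refl ≤-refl
    where
    Goal : ℕ → Set
    Goal v = ∀ N → g N ≡ v → N₀ ≤ N → ∃[ M ] (N₀ ≤ M × (∀ i → M ≤ i → g i ≡ g M))
    go : ∀ v → (∀ {u} → u < v → Goal u) → Goal v
    go v rec N gN≡v N₀≤N with em {∃[ i ] (N ≤ i × g i < g N)}
    ... | yes (i , N≤i , gi<gN) = rec (subst (g i <_) gN≡v gi<gN) i refl (≤-trans N₀≤N N≤i)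
    ... | no ¬drop = N , N₀≤N , λ i N≤i → ≤-antisym (atMost i N≤i) (≮⇒≥ (λ gi<gN → ¬drop (i , N≤i , gi<gN)))
      where
      atMost : ∀ i → N ≤ i → g i ≤ g N
      atMost = induction-from N ≤-refl (λ i N≤i gi≤gN → ≤-trans (nonincreasing i (≤-trans N₀≤N N≤i)) gi≤gN)

<∞-irrefl : ∀ o → ¬ (o <∞ o ≡ true)
<∞-irrefl nothing  ()
<∞-irrefl (just a) a<a = <-irrefl refl (<ᵇ⇒< a a (≡true⇒T a<a))

<∞-trans : ∀ o₁ o₂ o₃ → o₁ <∞ o₂ ≡ true → o₂ <∞ o₃ ≡ true → o₁ <∞ o₃ ≡ true
<∞-trans (just a) (just b) (just c) a<b b<c =
  T⇒≡true (<⇒<ᵇ (<-trans (<ᵇ⇒< a b (≡true⇒T a<b)) (<ᵇ⇒< b c (≡true⇒T b<c))))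
<∞-trans (just _) (just _) nothing  _ _ = refl
<∞-trans (just _) nothing  _        _ ()
<∞-trans nothing  _        _        () _

module KeyOrder {n : ℕ} (lt : Fin n → Fin n → Bool) where

  -- The data that decides the position of a state q in the next ordered set: whether q has a
  -- predecessor in the current one, Ord q, and its least such predecessor.
  Key : Set
  Key = Bool × ℕ∞ × Maybe (Fin n)

  _≺_ : Key → Key → Bool
  (false , o₁ , _)       ≺ (false , o₂ , _)       = o₁ <∞ o₂
  (true  , _  , _)       ≺ (false , _  , _)       = true
  (false , _  , _)       ≺ (true  , _  , _)       = false
  (true  , _  , just m₁) ≺ (true  , _  , just m₂) = lt m₁ m₂
  (true  , _  , _)       ≺ (true  , _  , _)       = false

  ≺-irrefl : (∀ z → ¬ (lt z z ≡ true)) → ∀ κ → ¬ (κ ≺ κ ≡ true)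
  ≺-irrefl _      (false , o , _)      = <∞-irrefl o
  ≺-irrefl irrefl (true  , _ , just z) = irrefl z
  ≺-irrefl _      (true  , _ , nothing) ()

  ≺-trans : (∀ a b c → lt a b ≡ true → lt b c ≡ true → lt a c ≡ true) →
    ∀ κ₁ κ₂ κ₃ → κ₁ ≺ κ₂ ≡ true → κ₂ ≺ κ₃ ≡ true → κ₁ ≺ κ₃ ≡ true
  ≺-trans _ (false , o₁ , _) (false , o₂ , _) (false , o₃ , _) p q = <∞-trans o₁ o₂ o₃ p q
  ≺-trans _ (false , _ , _) (false , _ , _) (true  , _ , _) _ ()
  ≺-trans _ (false , _ , _) (true  , _ , _) _               () _
  ≺-trans _ (true  , _ , _) (false , _ , _) (false , _ , _) _ _ = refl
  ≺-trans _ (true  , _ , _) (false , _ , _) (true  , _ , _) _ ()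
  ≺-trans _ (true  , _ , _) (true  , _ , _) (false , _ , _) _ _ = refl
  ≺-trans trans′ (true , _ , just a) (true , _ , just b) (true , _ , just c) p q = trans′ a b c p q
  ≺-trans _ (true , _ , just _)  (true , _ , just _)  (true , _ , nothing) _ ()
  ≺-trans _ (true , _ , just _)  (true , _ , nothing) (true , _ , _)       () _
  ≺-trans _ (true , _ , nothing) (true , _ , _)       (true , _ , _)       () _

  ≺-connex : ∀ (κ₁ κ₂ : Key) → let (h₁ , o₁ , m₁) = κ₁ ; (h₂ , o₂ , m₂) = κ₂ in
    (h₁ ≡ false → h₂ ≡ false → o₁ <∞ o₂ ≡ true ⊎ o₂ <∞ o₁ ≡ true) →
    (h₁ ≡ true → h₂ ≡ true →
       ∃[ a ] ∃[ b ] (m₁ ≡ just a × m₂ ≡ just b × (lt a b ≡ true ⊎ lt b a ≡ true))) →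
    κ₁ ≺ κ₂ ≡ true ⊎ κ₂ ≺ κ₁ ≡ true
  ≺-connex (false , _ , _) (false , _ , _) byOrd _ = byOrd refl refl
  ≺-connex (false , _ , _) (true  , _ , _) _ _ = inj₂ refl
  ≺-connex (true  , _ , _) (false , _ , _) _ _ = inj₁ refl
  ≺-connex (true  , _ , _) (true  , _ , _) _ byPred with byPred refl refl
  ... | _ , _ , refl , refl , a≶b = a≶b

  ≺-before-pred : ∀ h o m o′ b → (h , o , m) ≺ (true , o′ , just b) ≡ true →
    ∃[ a ] (h ≡ true × m ≡ just a × lt a b ≡ true)
  ≺-before-pred true _ (just a) _ _ a<b = a , refl , refl , a<b

-- The case split of colorB, in terms of b = |Q_d| and the least positions in Dec and Acc (if any).
colourOf : ℕ → Maybe ℕ → Maybe ℕ → ℕ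
colourOf b nothing  (just a) = 2 * a
colourOf b (just d) nothing  = 2 * d ∸ 1
colourOf b (just d) (just a) = (2 * a) ⊓ (2 * d ∸ 1)
colourOf b nothing  nothing  = 2 * b + 1

even-or-odd : ∀ c → ∃[ j ] (c ≡ 2 * j) ⊎ ∃[ j ] (c ≡ suc (2 * j))
even-or-odd zero = inj₁ (0 , refl)
even-or-odd (suc c) with even-or-odd c
... | inj₁ (j , c≡2j)   = inj₂ (j , cong suc c≡2j)
... | inj₂ (j , c≡1+2j) = inj₁ (suc j , trans (cong suc c≡1+2j) (sym (*-suc 2 j)))

2*suc∸1 : ∀ d → 2 * suc d ∸ 1 ≡ suc (2 * d)
2*suc∸1 d = cong (_∸ 1) (*-suc 2 d)

2*b+1≡1+2*b : ∀ b → 2 * b + 1 ≡ suc (2 * b)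
2*b+1≡1+2*b b = +-comm (2 * b) 1

module _ (b : ℕ) where

  colourOf-even : ∀ dm am → (∀ {d} → dm ≡ just d → 1 ≤ d) → ∀ j → colourOf b dm am ≡ 2 * j → am ≡ just j
  colourOf-even dm am dm-positive j e with dm | am | dm-positive
  ... | nothing | nothing | _   = contradiction (trans (sym e) (2*b+1≡1+2*b b)) (even≢odd j b)
  ... | nothing | just a  | _   = cong just (*-cancelˡ-≡ a j 2 e)
  ... | just (suc d) | nothing | _ = contradiction (trans (sym e) (2*suc∸1 d)) (even≢odd j d)
  ... | just zero    | _       | pos = contradiction (pos refl) λ ()
  ... | just (suc d) | just a  | _ with ⊓-sel (2 * a) (2 * suc d ∸ 1)
  ...   | inj₁ min≡2a = cong just (*-cancelˡ-≡ a j 2 (trans (sym min≡2a) e))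
  ...   | inj₂ min≡odd = contradiction (trans (sym e) (trans min≡odd (2*suc∸1 d))) (even≢odd j d)

  colourOf-odd : ∀ dm am → (∀ {d} → dm ≡ just d → 1 ≤ d) →
    ∀ j → colourOf b dm am ≡ suc (2 * j) → dm ≡ just (suc j) ⊎ (dm ≡ nothing × j ≡ b)
  colourOf-odd dm am dm-positive j e with dm | am | dm-positive
  ... | nothing | nothing | _ = inj₂ (refl , *-cancelˡ-≡ j b 2 (suc-injective (trans (sym e) (2*b+1≡1+2*b b))))
  ... | nothing | just a  | _ = contradiction e (even≢odd a j)
  ... | just zero    | _       | pos = contradiction (pos refl) λ ()
  ... | just (suc d) | nothing | _ =
    inj₁ (cong just (cong suc (*-cancelˡ-≡ d j 2 (suc-injective (trans (sym (2*suc∸1 d)) e)))))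
  ... | just (suc d) | just a  | _ with ⊓-sel (2 * a) (2 * suc d ∸ 1)
  ...   | inj₁ min≡2a = contradiction (trans (sym min≡2a) e) (even≢odd a j)
  ...   | inj₂ min≡odd = inj₁ (cong just (cong suc (*-cancelˡ-≡ d j 2
                           (suc-injective (trans (sym (2*suc∸1 d)) (trans (sym min≡odd) e))))))

colourOf-≤-acc : ∀ b dm {am a} → am ≡ just a → colourOf b dm am ≤ 2 * a
colourOf-≤-acc b nothing  refl = ≤-refl
colourOf-≤-acc b (just d) refl = m⊓n≤m _ _

colourOf-<-dec : ∀ b am {dm d} → dm ≡ just (suc d) → colourOf b dm am < 2 * suc d
colourOf-<-dec b nothing  refl = m≤pred[n]⇒suc[m]≤n ≤-refl
colourOf-<-dec b (just a) refl = ≤-<-trans (m⊓n≤n (2 * a) _) (colourOf-<-dec b nothing refl)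

module Correctness {n k : ℕ} (A : Buchi n k) (Qd : Subset n) (Ord : Fin n → ℕ∞)
  (isB : IsBuchi A) (isLD : IsLimitDet A Qd) (isO : IsOrdering Qd Ord) where
  open Buchi A
  open Construction A Qd Ord

  next : Fin n → Fin k → Fin n
  next q σ = proj₁ (proj₁ isB q σ)

  next-δ : ∀ q σ → δ q σ (next q σ) ≡ true
  next-δ q σ = proj₂ (proj₁ isB q σ)

  next-unique : ∀ {q σ q′} → Qd q ≡ true → δ q σ q′ ≡ true → q′ ≡ next q σ
  next-unique {q} {σ} {q′} qd δqq′ with proj₁ (proj₂ isLD) q qd σ
  ... | _ , _ , _ , unique = trans (unique q′ δqq′) (sym (unique (next q σ) (next-δ q σ)))

  next-Qd : ∀ {q} σ → Qd q ≡ true → Qd (next q σ) ≡ true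
  next-Qd {q} σ qd with proj₁ (proj₂ isLD) q qd σ
  ... | _ , _ , qd′ , unique = subst (λ z → Qd z ≡ true) (sym (unique (next q σ) (next-δ q σ))) qd′

  Qd-closed : ∀ {q σ q′} → Qd q ≡ true → δ q σ q′ ≡ true → Qd q′ ≡ true
  Qd-closed {σ = σ} qd δqq′ = subst (λ z → Qd z ≡ true) (sym (next-unique qd δqq′)) (next-Qd σ qd)

  record WellFormed (t : Subset n) (lt : Fin n → Fin n → Bool) : Set where
    field
      t⊆Qd  : ∀ x → t x ≡ true → Qd x ≡ true
      order : IsStrictTotalOn t lt
    open IsStrictTotalOn order public

  pointsTo : Maybe (Fin n) → Fin n → Bool
  pointsTo (just m) z = eqᵇ m z
  pointsTo nothing  _ = false

  pointsTo⇒≡ : ∀ mm z → pointsTo mm z ≡ true → mm ≡ just z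
  pointsTo⇒≡ (just m) z p = cong just (eqᵇ⇒≡ p)

  α-resp : ∀ {a a′ σ b b′} → a ≡ a′ → b ≡ b′ → α a σ b ≡ true → α a′ σ b′ ≡ true
  α-resp refl refl αab = αab

  module Step (s₁ t₁ : Subset n) (lt₁ : Fin n → Fin n → Bool) (σ : Fin k) (wf₁ : WellFormed t₁ lt₁) where
    open WellFormed wf₁
    open KeyOrder lt₁
    open Position order using (below; Ind-≤⇒≼; Ind-≤-count)

    s₂ t₂ : Subset n
    s₂ = BState.s (transB ⟨ s₁ , t₁ , lt₁ ⟩ σ)
    t₂ = BState.t (transB ⟨ s₁ , t₁ , lt₁ ⟩ σ)

    lt₂ : Fin n → Fin n → Bool
    lt₂ = BState.lt (transB ⟨ s₁ , t₁ , lt₁ ⟩ σ)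

    preds : Fin n → Subset n
    preds q y = t₁ y ∧ δ y σ q

    minPred : Fin n → Maybe (Fin n)
    minPred q = minBy lt₁ (preds q)

    key : Fin n → Key
    key q = hasPred t₁ σ q , Ord q , minPred q

    lt₂-char : ∀ x y → lt₂ x y ≡ (t₂ x ∧ t₂ y ∧ (key x ≺ key y))
    lt₂-char x y with hasPred t₁ σ x | hasPred t₁ σ y | minPred x | minPred y
    ... | false | false | _       | _       rewrite ∨-identityʳ (Ord x <∞ Ord y) = refl
    ... | true  | false | _       | _       = refl
    ... | false | true  | _       | _       = refl
    ... | true  | true  | just _  | just _  = refl
    ... | true  | true  | just _  | nothing = refl
    ... | true  | true  | nothing | just _  = refl
    ... | true  | true  | nothing | nothing = refl

    lt₂-elim : ∀ x y → lt₂ x y ≡ true → t₂ x ≡ true × t₂ y ≡ true × key x ≺ key y ≡ true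
    lt₂-elim x y x<y = let p = trans (sym (lt₂-char x y)) x<y in
      ∧-elimˡ p , ∧-elimˡ (∧-elimʳ {t₂ x} p) , ∧-elimʳ {t₂ y} (∧-elimʳ {t₂ x} p)

    lt₂-intro : ∀ x y → t₂ x ≡ true → t₂ y ≡ true → key x ≺ key y ≡ true → lt₂ x y ≡ true
    lt₂-intro x y tx ty x≺y = trans (lt₂-char x y) (∧-intro tx (∧-intro ty x≺y))

    ∈t₂-intro : ∀ x q → (s₁ x ∨ t₁ x) ≡ true → δ x σ q ≡ true → Qd q ≡ true → t₂ q ≡ true
    ∈t₂-intro x q x∈ δxq qd = ∧-intro (anyF-intro (λ x → (s₁ x ∨ t₁ x) ∧ δ x σ q) x (∧-intro x∈ δxq)) qd

    ∈t₂-elim : ∀ q → t₂ q ≡ true → Qd q ≡ true × ∃[ x ] ((s₁ x ∨ t₁ x) ≡ true × δ x σ q ≡ true)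
    ∈t₂-elim q q∈ = let (x , p) = anyF-elim (λ x → (s₁ x ∨ t₁ x) ∧ δ x σ q) (∧-elimˡ q∈) in
      ∧-elimʳ {post σ (λ x → s₁ x ∨ t₁ x) q} q∈ , x , ∧-elimˡ p , ∧-elimʳ {s₁ x ∨ t₁ x} p

    ∈s₂-intro : ∀ x q → s₁ x ≡ true → δ x σ q ≡ true → Qd q ≡ false → s₂ q ≡ true
    ∈s₂-intro x q x∈ δxq qd rewrite qd = ∧-intro (anyF-intro (λ x → s₁ x ∧ δ x σ q) x (∧-intro x∈ δxq)) refl

    ∈s₂-elim : ∀ q → s₂ q ≡ true → ∃[ x ] (s₁ x ≡ true × δ x σ q ≡ true)
    ∈s₂-elim q q∈ = let (x , p) = anyF-elim (λ x → s₁ x ∧ δ x σ q) (∧-elimˡ q∈) in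
      x , ∧-elimˡ p , ∧-elimʳ {s₁ x} p

    next-∈t₂ : ∀ y → t₁ y ≡ true → t₂ (next y σ) ≡ true
    next-∈t₂ y ty = ∈t₂-intro y (next y σ) (∨-introʳ {s₁ y} ty) (next-δ y σ) (next-Qd σ (t⊆Qd y ty))

    preds⇒next : ∀ q y → preds q y ≡ true → q ≡ next y σ
    preds⇒next q y p = next-unique (t⊆Qd y (∧-elimˡ p)) (∧-elimʳ {t₁ y} p)

    next-preds : ∀ y → t₁ y ≡ true → preds (next y σ) y ≡ true
    next-preds y ty = ∧-intro ty (next-δ y σ)

    minPred-least : ∀ q m → minPred q ≡ just m →
      t₁ m ≡ true × next m σ ≡ q × (∀ y → t₁ y ≡ true → next y σ ≡ q → y ≡ m ⊎ lt₁ m y ≡ true)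
    minPred-least q m e = let (pm , least) = minBy-least lt₁ (preds q) e in
      ∧-elimˡ pm , sym (preds⇒next q m pm) ,
      λ y ty ny≡q → least y (subst (λ z → preds z y ≡ true) ny≡q (next-preds y ty))

    minPred-exists : ∀ q y → preds q y ≡ true → ∃[ m ] (minPred q ≡ just m)
    minPred-exists q y = minBy-exists lt₁ (preds q) order (λ x p → ∧-elimˡ p) y

    hasPred⇒minPred : ∀ q → hasPred t₁ σ q ≡ true → ∃[ m ] (minPred q ≡ just m)
    hasPred⇒minPred q h = let (y , p) = anyF-elim (preds q) h in minPred-exists q y p

    minPred⇒hasPred : ∀ q m → minPred q ≡ just m → hasPred t₁ σ q ≡ true
    minPred⇒hasPred q m e = anyF-intro (preds q) m (proj₁ (minBy-least lt₁ (preds q) e))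

    next-hasPred : ∀ y → t₁ y ≡ true → hasPred t₁ σ (next y σ) ≡ true
    next-hasPred y ty = anyF-intro (preds (next y σ)) y (next-preds y ty)

    wf₂ : WellFormed t₂ lt₂
    wf₂ = record
      { t⊆Qd  = λ x x∈ → proj₁ (∈t₂-elim x x∈)
      ; order = record
        { lt-⊆      = λ x y x<y → let (tx , ty , _) = lt₂-elim x y x<y in tx , ty
        ; lt-irrefl = λ x x<x → ≺-irrefl lt-irrefl (key x) (proj₂ (proj₂ (lt₂-elim x x x<x)))
        ; lt-trans  = λ x y z x<y y<z → let (tx , _ , x≺y) = lt₂-elim x y x<y ; (_ , tz , y≺z) = lt₂-elim y z y<z in
            lt₂-intro x z tx tz (≺-trans lt-trans (key x) (key y) (key z) x≺y y≺z)
        ; lt-tri    = tri₂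
        }
      }
      where
      byOrd : ∀ x y → x ≢ y → t₂ x ≡ true → t₂ y ≡ true → Ord x <∞ Ord y ≡ true ⊎ Ord y <∞ Ord x ≡ true
      byOrd x y x≢y tx ty
        with proj₁ (proj₂ isO) x (proj₁ (∈t₂-elim x tx)) | proj₁ (proj₂ isO) y (proj₁ (∈t₂-elim y ty))
      ... | a , ordx , _ | b , ordy , _ rewrite ordx | ordy with <-cmp a b
      ...   | tri< a<b _ _ = inj₁ (T⇒≡true (<⇒<ᵇ a<b))
      ...   | tri> _ _ b<a = inj₂ (T⇒≡true (<⇒<ᵇ b<a))
      ...   | tri≈ _ refl _ = contradiction (proj₂ (proj₂ isO) x y (proj₁ (∈t₂-elim x tx)) (proj₁ (∈t₂-elim y ty))
                                              (trans ordx (sym ordy))) x≢y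
      byPred : ∀ x y → x ≢ y → hasPred t₁ σ x ≡ true → hasPred t₁ σ y ≡ true →
        ∃[ a ] ∃[ b ] (minPred x ≡ just a × minPred y ≡ just b × (lt₁ a b ≡ true ⊎ lt₁ b a ≡ true))
      byPred x y x≢y hx hy with hasPred⇒minPred x hx | hasPred⇒minPred y hy
      ... | a , ea | b , eb with minPred-least x a ea | minPred-least y b eb
      ...   | ta , na≡x , _ | tb , nb≡y , _ with lt-tri a b ta tb
      ...     | inj₁ refl = contradiction (trans (sym na≡x) nb≡y) x≢y
      ...     | inj₂ a≶b = a , b , ea , eb , a≶b
      tri₂ : ∀ x y → t₂ x ≡ true → t₂ y ≡ true → x ≡ y ⊎ lt₂ x y ≡ true ⊎ lt₂ y x ≡ true
      tri₂ x y tx ty with x ≟ y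
      ... | yes x≡y = inj₁ x≡y
      ... | no x≢y = inj₂ (⊎-map (lt₂-intro x y tx ty) (lt₂-intro y x ty tx)
              (≺-connex (key x) (key y) (λ _ _ → byOrd x y x≢y tx ty) (byPred x y x≢y)))

    -- Positions of successors in t₂ are counted by the leaders: the states of t₁ that are the
    -- least predecessor of their own successor.
    leader : Subset n
    leader z = t₁ z ∧ pointsTo (minPred (next z σ)) z

    leaderBelow : Fin n → Subset n
    leaderBelow m z = leader z ∧ lt₁ z m

    leader-intro : ∀ z → t₁ z ≡ true → minPred (next z σ) ≡ just z → leader z ≡ true
    leader-intro z tz e rewrite e = ∧-intro tz (eqᵇ-refl z)

    leader-elim : ∀ z → leader z ≡ true → t₁ z ≡ true × minPred (next z σ) ≡ just z
    leader-elim z p = ∧-elimˡ p , pointsTo⇒≡ (minPred (next z σ)) z (∧-elimʳ {t₁ z} p)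

    lt₂-next-elim : ∀ x y m → t₁ y ≡ true → minPred (next y σ) ≡ just m → lt₂ x (next y σ) ≡ true →
      ∃[ a ] (minPred x ≡ just a × lt₁ a m ≡ true)
    lt₂-next-elim x y m ty em x<ny with lt₂-elim x (next y σ) x<ny
    ... | _ , _ , x≺ny rewrite next-hasPred y ty | em =
      let (a , _ , ea , a<m) = ≺-before-pred (hasPred t₁ σ x) (Ord x) (minPred x) (Ord (next y σ)) m x≺ny in
      a , ea , a<m

    lt₂-next-intro : ∀ x a y m → t₂ x ≡ true → minPred x ≡ just a →
      t₁ y ≡ true → minPred (next y σ) ≡ just m → lt₁ a m ≡ true → lt₂ x (next y σ) ≡ true
    lt₂-next-intro x a y m tx ea ty em a<m = lt₂-intro x (next y σ) tx (next-∈t₂ y ty) x≺ny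
      where
      x≺ny : key x ≺ key (next y σ) ≡ true
      x≺ny rewrite minPred⇒hasPred x a ea | ea | next-hasPred y ty | em = a<m

    Ind-next : ∀ y m → t₁ y ≡ true → minPred (next y σ) ≡ just m →
      Ind t₂ lt₂ (next y σ) ≡ suc (countF (leaderBelow m))
    Ind-next y m ty em = cong suc (≤-antisym (countF-injection P Q toLeader into₁ inj₁′)
                                             (countF-injection Q P (λ z → next z σ) into₂ inj₂′))
      where
      P Q : Subset n
      P x = t₂ x ∧ lt₂ x (next y σ)
      Q = leaderBelow m
      toLeader : Fin n → Fin n
      toLeader x with minPred x
      ... | just a  = a
      ... | nothing = x
      into₁ : ∀ x → P x ≡ true → Q (toLeader x) ≡ true
      into₁ x p with lt₂-next-elim x y m ty em (∧-elimʳ {t₂ x} p)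
      ... | a , ea , a<m rewrite ea =
        let (ta , na≡x , _) = minPred-least x a ea in ∧-intro (leader-intro a ta (trans (cong minPred na≡x) ea)) a<m
      inj₁′ : ∀ x x′ → P x ≡ true → P x′ ≡ true → toLeader x ≡ toLeader x′ → x ≡ x′
      inj₁′ x x′ p p′ e
        with lt₂-next-elim x y m ty em (∧-elimʳ {t₂ x} p) | lt₂-next-elim x′ y m ty em (∧-elimʳ {t₂ x′} p′)
      ... | a , ea , _ | a′ , ea′ , _ rewrite ea | ea′ =
        trans (sym (proj₁ (proj₂ (minPred-least x a ea))))
              (trans (cong (λ z → next z σ) e) (proj₁ (proj₂ (minPred-least x′ a′ ea′))))
      into₂ : ∀ z → Q z ≡ true → P (next z σ) ≡ true
      into₂ z q = let (tz , ez) = leader-elim z (∧-elimˡ q) in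
        ∧-intro (next-∈t₂ z tz) (lt₂-next-intro (next z σ) z y m (next-∈t₂ z tz) ez ty em (∧-elimʳ {leader z} q))
      inj₂′ : ∀ z z′ → Q z ≡ true → Q z′ ≡ true → next z σ ≡ next z′ σ → z ≡ z′
      inj₂′ z z′ q q′ e = just-injective (trans (sym (proj₂ (leader-elim z (∧-elimˡ q))))
                                                (trans (cong minPred e) (proj₂ (leader-elim z′ (∧-elimˡ q′)))))

    Decreases : Fin n → Set
    Decreases y = Ind t₂ lt₂ (next y σ) < Ind t₁ lt₁ y

    leaderBelow⊆below : ∀ y m → t₁ y ≡ true → minPred (next y σ) ≡ just m →
      ∀ z → leaderBelow m z ≡ true → below y z ≡ true
    leaderBelow⊆below y m ty em z p with proj₂ (proj₂ (minPred-least (next y σ) m em)) y ty refl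
    ... | inj₁ refl = ∧-intro (∧-elimˡ (∧-elimˡ p)) (∧-elimʳ {leader z} p)
    ... | inj₂ m<y  = ∧-intro (∧-elimˡ (∧-elimˡ p)) (lt-trans z m y (∧-elimʳ {leader z} p) m<y)

    Ind-next-≤ : ∀ y → t₁ y ≡ true → Ind t₂ lt₂ (next y σ) ≤ Ind t₁ lt₁ y
    Ind-next-≤ y ty with minPred-exists (next y σ) y (next-preds y ty)
    ... | m , em rewrite Ind-next y m ty em = s≤s (countF-mono _ (below y) (leaderBelow⊆below y m ty em))

    non-leader⇒decreases : ∀ y → t₁ y ≡ true → ∀ z → (z ≡ y ⊎ lt₁ z y ≡ true) → leader z ≡ false →
      Decreases y
    non-leader⇒decreases y ty z z≼y lz with minPred-exists (next y σ) y (next-preds y ty)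
    ... | m , em rewrite Ind-next y m ty em = s≤s (missing z≼y (proj₂ (proj₂ (minPred-least (next y σ) m em)) y ty refl))
      where
      count<below : ∀ w → below y w ≡ true → leaderBelow m w ≡ false → countF (leaderBelow m) < countF (below y)
      count<below = countF-mono-< _ (below y) (leaderBelow⊆below y m ty em)
      missing : (z ≡ y ⊎ lt₁ z y ≡ true) → (y ≡ m ⊎ lt₁ m y ≡ true) → countF (leaderBelow m) < countF (below y)
      missing (inj₁ refl) (inj₁ refl) = contradiction lz (true≢false (leader-intro z ty em))
      missing (inj₁ refl) (inj₂ m<y) = count<below m (∧-intro (proj₁ (minPred-least (next y σ) m em)) m<y)
                                         (¬true⇒false (lt-irrefl m ∘ ∧-elimʳ {leader m}))
      missing (inj₂ z<y) _ =
        count<below z (∧-intro (proj₁ (lt-⊆ z y z<y)) z<y) (subst (λ b → b ∧ lt₁ z m ≡ false) (sym lz) refl)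

    decreases⇒non-leader : ∀ q → t₁ q ≡ true → Decreases q →
      ∃[ z ] ((z ≡ q ⊎ lt₁ z q ≡ true) × leader z ≡ false)
    decreases⇒non-leader q tq dec with leader q in lq
    ... | false = q , inj₁ refl , lq
    ... | true with anyF (λ z → below q z ∧ not (leader z)) in e
    ...   | true = let (z , p) = anyF-elim _ e in
                   z , inj₂ (∧-elimʳ {t₁ z} (∧-elimˡ p)) , not-injective (∧-elimʳ {below q z} p)
    ...   | false = contradiction dec (≤⇒≯ (subst (Ind t₁ lt₁ q ≤_) (sym (Ind-next q q tq (proj₂ (leader-elim q lq))))
                                          (s≤s (countF-mono (below q) _ allLeaders))))
      where
      allLeaders : ∀ z → below q z ≡ true → leaderBelow q z ≡ true
      allLeaders z zq with leader z in lz
      ... | true  = ∧-elimʳ {t₁ z} zq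
      ... | false = contradiction (anyF-false _ e z) (true≢false (∧-intro zq (cong not lz)))

    decreases-upward : ∀ q r → t₁ q ≡ true → t₁ r ≡ true → Ind t₁ lt₁ q ≤ Ind t₁ lt₁ r →
      Decreases q → Decreases r
    decreases-upward q r tq tr Iq≤Ir dec with decreases⇒non-leader q tq dec | Ind-≤⇒≼ q r tq tr Iq≤Ir
    ... | z , z≼q , lz          | inj₁ refl = non-leader⇒decreases q tq z z≼q lz
    ... | z , inj₁ refl , lz    | inj₂ q<r  = non-leader⇒decreases r tr z (inj₂ q<r) lz
    ... | z , inj₂ z<q , lz     | inj₂ q<r  = non-leader⇒decreases r tr z (inj₂ (lt-trans z q r z<q q<r)) lz

    isDec isAcc : Fin n → Bool
    isDec q = anyF (λ q′ → δ q σ q′ ∧ (Ind t₂ lt₂ q′ <ᵇ Ind t₁ lt₁ q))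
    isAcc q = anyF (λ q′ → t₂ q′ ∧ α q σ q′)

    decMin accMin : Maybe ℕ
    decMin = minValF (λ q → t₁ q ∧ isDec q) (Ind t₁ lt₁)
    accMin = minValF (λ q → t₁ q ∧ isAcc q) (Ind t₁ lt₁)

    colour : ℕ
    colour = colorB ⟨ s₁ , t₁ , lt₁ ⟩ σ

    colour≡colourOf : colour ≡ colourOf (countF Qd) decMin accMin
    colour≡colourOf with decMin | accMin
    ... | nothing | nothing = refl
    ... | nothing | just _  = refl
    ... | just _  | nothing = refl
    ... | just _  | just _  = refl

    decMin-positive : ∀ {d} → decMin ≡ just d → 1 ≤ d
    decMin-positive e with minValF-attained _ (Ind t₁ lt₁) e
    ... | _ , _ , refl = s≤s z≤n

    isDec⇒decreases : ∀ q → t₁ q ≡ true → isDec q ≡ true → Decreases q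
    isDec⇒decreases q tq p = let (q′ , e) = anyF-elim _ p in
      subst (λ z → Ind t₂ lt₂ z < Ind t₁ lt₁ q) (next-unique (t⊆Qd q tq) (∧-elimˡ e))
        (<ᵇ⇒< _ _ (≡true⇒T (∧-elimʳ {δ q σ q′} e)))

    decreases⇒isDec : ∀ q → Decreases q → isDec q ≡ true
    decreases⇒isDec q dec = anyF-intro (λ q′ → δ q σ q′ ∧ (Ind t₂ lt₂ q′ <ᵇ Ind t₁ lt₁ q)) (next q σ)
      (∧-intro (next-δ q σ) (T⇒≡true (<⇒<ᵇ dec)))

    isAcc⇒α-next : ∀ q → t₁ q ≡ true → isAcc q ≡ true → α q σ (next q σ) ≡ true
    isAcc⇒α-next q tq acc =
      let (q′ , p) = anyF-elim (λ q′ → t₂ q′ ∧ α q σ q′) acc ; αqq′ = ∧-elimʳ {t₂ q′} p in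
      α-resp refl (next-unique (t⊆Qd q tq) (proj₂ isB q σ q′ αqq′)) αqq′

    -- The odd colour comes from a decreasing state at or below r, and decreasing propagates upwards.
    odd-colour⇒decreases : ∀ r → t₁ r ≡ true → ∀ j → colour ≡ suc (2 * j) → suc (2 * j) < 2 * Ind t₁ lt₁ r →
      Decreases r
    odd-colour⇒decreases r tr j e small
      with colourOf-odd (countF Qd) decMin accMin decMin-positive j (trans (sym colour≡colourOf) e)
    ... | inj₂ (_ , refl) = contradiction (<-≤-trans small (*-monoʳ-≤ 2 (Ind-≤-count Qd t⊆Qd r tr)))
                              (1+n≰n ∘ <⇒≤)
    ... | inj₁ ed with minValF-attained _ (Ind t₁ lt₁) ed
    ...   | q , dq , Iq≡1+j = decreases-upward q r (∧-elimˡ dq) tr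
              (subst (_≤ Ind t₁ lt₁ r) (sym Iq≡1+j) (*-cancelˡ-< 2 j (Ind t₁ lt₁ r) (<-trans (n<1+n (2 * j)) small)))
              (isDec⇒decreases q (∧-elimˡ dq) (∧-elimʳ {t₁ q} dq))

    acc⇒colour-≤ : ∀ r → t₁ r ≡ true → isAcc r ≡ true → colour ≤ 2 * Ind t₁ lt₁ r
    acc⇒colour-≤ r tr acc with minValF-≤ _ (Ind t₁ lt₁) r (∧-intro tr acc)
    ... | a , ea , a≤Ir = subst (_≤ 2 * Ind t₁ lt₁ r) (sym colour≡colourOf)
                            (≤-trans (colourOf-≤-acc (countF Qd) decMin ea) (*-monoʳ-≤ 2 a≤Ir))

    decreases⇒colour-< : ∀ q → t₁ q ≡ true → Decreases q → colour < 2 * Ind t₁ lt₁ q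
    decreases⇒colour-< q tq dec with minValF-≤ _ (Ind t₁ lt₁) q (∧-intro tq (decreases⇒isDec q dec))
    ... | d , ed , d≤Iq with minValF-attained _ (Ind t₁ lt₁) ed
    ...   | _ , _ , refl = subst (_< 2 * Ind t₁ lt₁ q) (sym colour≡colourOf)
                             (<-≤-trans (colourOf-<-dec (countF Qd) accMin ed) (*-monoʳ-≤ 2 d≤Iq))

    even-colour⇒acc : ∀ j → colour ≡ 2 * j → ∃[ q ] (t₁ q ≡ true × isAcc q ≡ true × Ind t₁ lt₁ q ≡ j)
    even-colour⇒acc j e with minValF-attained _ (Ind t₁ lt₁)
                               (colourOf-even (countF Qd) decMin accMin decMin-positive j (trans (sym colour≡colourOf) e))
    ... | q , aq , Iq≡j = q , ∧-elimˡ aq , ∧-elimʳ {t₁ q} aq , Iq≡j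

  δ-resp : ∀ {a a′ σ b b′} → a ≡ a′ → b ≡ b′ → δ a σ b ≡ true → δ a′ σ b′ ≡ true
  δ-resp refl refl δab = δab

  extend : (ℕ → Fin n) → ℕ → Fin n → ℕ → Fin n
  extend ρ i q l with l ≤? i
  ... | yes _ = ρ l
  ... | no _  = q

  extend-≤ : ∀ ρ i q l → l ≤ i → extend ρ i q l ≡ ρ l
  extend-≤ ρ i q l l≤i with l ≤? i
  ... | yes _ = refl
  ... | no l≰i = contradiction l≤i l≰i

  extend-suc : ∀ ρ i q → extend ρ i q (suc i) ≡ q
  extend-suc ρ i q with suc i ≤? i
  ... | yes 1+i≤i = contradiction 1+i≤i (1+n≰n)
  ... | no _      = refl

  followFrom : (ℕ → Fin n) → ℕ → Word k → ℕ → Fin n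
  followFrom ρ i₀ w zero    = ρ zero
  followFrom ρ i₀ w (suc l) with suc l ≤? i₀
  ... | yes _ = ρ (suc l)
  ... | no _  = next (followFrom ρ i₀ w l) (w l)

  followFrom-≤ : ∀ ρ i₀ w l → l ≤ i₀ → followFrom ρ i₀ w l ≡ ρ l
  followFrom-≤ ρ i₀ w zero    _ = refl
  followFrom-≤ ρ i₀ w (suc l) l≤i₀ with suc l ≤? i₀
  ... | yes _    = refl
  ... | no l≰i₀ = contradiction l≤i₀ l≰i₀

  followFrom-next : ∀ ρ i₀ w l → i₀ ≤ l → followFrom ρ i₀ w (suc l) ≡ next (followFrom ρ i₀ w l) (w l)
  followFrom-next ρ i₀ w l i₀≤l with suc l ≤? i₀
  ... | yes l<i₀ = contradiction (≤-trans l<i₀ i₀≤l) 1+n≰n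
  ... | no _     = refl

  followFrom-δ : ∀ ρ i₀ w → (∀ l → l < i₀ → δ (ρ l) (w l) (ρ (suc l)) ≡ true) →
    ∀ l → δ (followFrom ρ i₀ w l) (w l) (followFrom ρ i₀ w (suc l)) ≡ true
  followFrom-δ ρ i₀ w ρδ l = [ before , after ]′ (<-≤-connex l i₀)
    where
    before : l < i₀ → δ (followFrom ρ i₀ w l) (w l) (followFrom ρ i₀ w (suc l)) ≡ true
    before l<i₀ = δ-resp (sym (followFrom-≤ ρ i₀ w l (<⇒≤ l<i₀))) (sym (followFrom-≤ ρ i₀ w (suc l) l<i₀))
                         (ρδ l l<i₀)
    after : i₀ ≤ l → δ (followFrom ρ i₀ w l) (w l) (followFrom ρ i₀ w (suc l)) ≡ true
    after i₀≤l = δ-resp refl (sym (followFrom-next ρ i₀ w l i₀≤l)) (next-δ (followFrom ρ i₀ w l) (w l))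

  module Run (em : ExcludedMiddle 0ℓ) (w : Word k) where
    open Classical em

    sAt tAt : ℕ → Subset n
    sAt i = BState.s (runD B w i)
    tAt i = BState.t (runD B w i)

    ltAt : ℕ → Fin n → Fin n → Bool
    ltAt i = BState.lt (runD B w i)

    wfAt : ∀ i → WellFormed (tAt i) (ltAt i)
    wfAt zero = record
      { t⊆Qd  = λ _ ()
      ; order = record { lt-⊆ = λ _ _ () ; lt-irrefl = λ _ () ; lt-trans = λ _ _ _ () ; lt-tri = λ _ _ () }
      }
    wfAt (suc i) = Step.wf₂ (sAt i) (tAt i) (ltAt i) (w i) (wfAt i)

    module At (i : ℕ) = Step (sAt i) (tAt i) (ltAt i) (w i) (wfAt i)

    IndAt : ℕ → Fin n → ℕ
    IndAt i = Ind (tAt i) (ltAt i)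

    col : ℕ → ℕ
    col = colorAt B w

    Path : ℕ → Fin n → Set
    Path i q = Σ[ ρ ∈ (ℕ → Fin n) ]
                 (ρ 0 ≡ q₀ × ρ i ≡ q × (∀ l → l < i → δ (ρ l) (w l) (ρ (suc l)) ≡ true))

    predecessor : ∀ i q → (sAt (suc i) q ≡ true ⊎ tAt (suc i) q ≡ true) →
      ∃[ x ] ((sAt i x ≡ true ⊎ tAt i x ≡ true) × δ x (w i) q ≡ true)
    predecessor i q (inj₁ q∈s) = let (x , x∈ , δxq) = At.∈s₂-elim i q q∈s in x , inj₁ x∈ , δxq
    predecessor i q (inj₂ q∈t) = let (_ , x , x∈ , δxq) = At.∈t₂-elim i q q∈t in x , ∨-elim {sAt i x} x∈ , δxq

    Path-extend : ∀ i x q → Path i x → δ x (w i) q ≡ true → Path (suc i) q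
    Path-extend i x q (ρ , ρ0 , ρi , ρδ) δxq = extend ρ i q , trans (extend-≤ ρ i q 0 z≤n) ρ0 , extend-suc ρ i q , steps
      where
      steps : ∀ l → l < suc i → δ (extend ρ i q l) (w l) (extend ρ i q (suc l)) ≡ true
      steps l l<1+i with m<1+n⇒m<n∨m≡n l<1+i
      ... | inj₁ l<i = δ-resp (sym (extend-≤ ρ i q l (<⇒≤ l<i))) (sym (extend-≤ ρ i q (suc l) l<i)) (ρδ l l<i)
      ... | inj₂ refl = δ-resp (sym (trans (extend-≤ ρ l q l ≤-refl) ρi)) (sym (extend-suc ρ l q)) δxq

    reachable : ∀ i q → (sAt i q ≡ true ⊎ tAt i q ≡ true) → Path i q
    reachable zero    q (inj₁ q∈s) = (λ _ → q₀) , refl , eqᵇ⇒≡ q∈s , λ _ ()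
    reachable (suc i) q q∈ = let (x , x∈ , δxq) = predecessor i q q∈ in Path-extend i x q (reachable i x x∈) δxq

    module Forward (ρ : ℕ → Fin n) (ρ0 : ρ 0 ≡ q₀) (ρδ : ∀ i → δ (ρ i) (w i) (ρ (suc i)) ≡ true)
                   (acc : IsAcceptingRun A w ρ) where
      tracked : ∀ i → (Qd (ρ i) ≡ false × sAt i (ρ i) ≡ true) ⊎ (Qd (ρ i) ≡ true × tAt i (ρ i) ≡ true)
      tracked zero rewrite ρ0 = inj₁ (proj₂ (proj₂ isLD) , eqᵇ-refl q₀)
      tracked (suc i) with tracked i | Qd (ρ (suc i)) Bool.≟ true
      ... | inj₁ (_ , s) | no qd  =
        inj₁ (¬true⇒false qd , At.∈s₂-intro i (ρ i) (ρ (suc i)) s (ρδ i) (¬true⇒false qd))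
      ... | inj₁ (_ , s) | yes qd = inj₂ (qd , At.∈t₂-intro i (ρ i) (ρ (suc i)) (∨-introˡ s) (ρδ i) qd)
      ... | inj₂ (_ , t) | yes qd = inj₂ (qd , At.∈t₂-intro i (ρ i) (ρ (suc i)) (∨-introʳ {sAt i (ρ i)} t) (ρδ i) qd)
      ... | inj₂ (q , _) | no qd  = contradiction (Qd-closed q (ρδ i)) qd

      N₀ : ℕ
      N₀ = proj₁ (acc 0)

      inQd : ∀ i → N₀ ≤ i → Qd (ρ i) ≡ true
      inQd = induction-from N₀ (proj₁ (proj₁ isLD _ _ _ (proj₂ (proj₂ (acc 0)))))
        (λ i _ qd → Qd-closed qd (ρδ i))

      inT : ∀ i → N₀ ≤ i → tAt i (ρ i) ≡ true
      inT i N₀≤i with tracked i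
      ... | inj₁ (notQd , _) = contradiction notQd (true≢false (inQd i N₀≤i))
      ... | inj₂ (_ , ρi∈t)  = ρi∈t

      ρ-next : ∀ i → N₀ ≤ i → ρ (suc i) ≡ next (ρ i) (w i)
      ρ-next i N₀≤i = next-unique (inQd i N₀≤i) (ρδ i)

      position : ℕ → ℕ
      position i = IndAt i (ρ i)

      position-suc : ∀ i → N₀ ≤ i → position (suc i) ≡ IndAt (suc i) (next (ρ i) (w i))
      position-suc i N₀≤i = cong (IndAt (suc i)) (ρ-next i N₀≤i)

      position-nonincreasing : ∀ i → N₀ ≤ i → position (suc i) ≤ position i
      position-nonincreasing i N₀≤i =
        subst (_≤ position i) (sym (position-suc i N₀≤i)) (At.Ind-next-≤ i (ρ i) (inT i N₀≤i))

      module Stable (M : ℕ) (N₀≤M : N₀ ≤ M) (position-stable : ∀ i → M ≤ i → position i ≡ position M) where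

        m : ℕ
        m = position M

        no-small-odd-colour : ∀ i → M ≤ i → ∀ j → col i ≡ suc (2 * j) → ¬ (suc (2 * j) < 2 * m)
        no-small-odd-colour i M≤i j odd small = <-irrefl stays (subst (_< position i) (sym (position-suc i N₀≤i)) drops)
          where
          N₀≤i : N₀ ≤ i
          N₀≤i = ≤-trans N₀≤M M≤i
          drops : At.Decreases i (ρ i)
          drops = At.odd-colour⇒decreases i (ρ i) (inT i N₀≤i) j odd
                    (subst (λ p → suc (2 * j) < 2 * p) (sym (position-stable i M≤i)) small)
          stays : position (suc i) ≡ position i
          stays = trans (position-stable (suc i) (m≤n⇒m≤1+n M≤i)) (sym (position-stable i M≤i))

        small-colour-frequently : Frequently (λ i → col i ≤ 2 * m)
        small-colour-frequently N = i , ≤-trans (m≤m⊔n N M) N⊔M≤i ,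
            subst (λ p → col i ≤ 2 * p) (position-stable i M≤i) (At.acc⇒colour-≤ i (ρ i) (inT i N₀≤i) ρi-acc)
          where
          i : ℕ
          i = proj₁ (acc (N ⊔ M))
          N⊔M≤i : N ⊔ M ≤ i
          N⊔M≤i = proj₁ (proj₂ (acc (N ⊔ M)))
          M≤i : M ≤ i
          M≤i = ≤-trans (m≤n⊔m N M) N⊔M≤i
          N₀≤i : N₀ ≤ i
          N₀≤i = ≤-trans N₀≤M M≤i
          ρi-acc : At.isAcc i (ρ i) ≡ true
          ρi-acc = anyF-intro (λ q′ → tAt (suc i) q′ ∧ α (ρ i) (w i) q′) (ρ (suc i))
                     (∧-intro (inT (suc i) (m≤n⇒m≤1+n N₀≤i)) (proj₂ (proj₂ (acc (N ⊔ M)))))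

        accepted : AcceptsD B w
        accepted with least-frequent-value col (2 * m) small-colour-frequently
        ... | c , c≤2m , frequent , least = c , frequent , even (even-or-odd c) , least
          where
          even : (∃[ j ] (c ≡ 2 * j) ⊎ ∃[ j ] (c ≡ suc (2 * j))) → 2 ∣ c
          even (inj₁ (j , c≡2j))   = subst (2 ∣_) (sym c≡2j) (m∣m*n j)
          even (inj₂ (j , c≡1+2j)) =
            let (i , M≤i , coli≡c) = frequent M in
            contradiction (≤∧≢⇒< (subst (_≤ 2 * m) c≡1+2j c≤2m) (λ e → even≢odd m j (sym e)))
                          (no-small-odd-colour i M≤i j (trans coli≡c c≡1+2j))

      accepted : AcceptsD B w
      accepted = let (M , N₀≤M , stable) = eventually-constant position N₀ position-nonincreasing in
        Stable.accepted M N₀≤M stable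

    module Backward (j : ℕ) (frequent : FrequentValue col (2 * j))
                    (N : ℕ) (colour-≥ : ∀ i → N ≤ i → 2 * j ≤ col i) where

      i₀ : ℕ
      i₀ = proj₁ (frequent N)

      N≤i₀ : N ≤ i₀
      N≤i₀ = proj₁ (proj₂ (frequent N))

      witness : ∃[ q ] (tAt i₀ q ≡ true × At.isAcc i₀ q ≡ true × IndAt i₀ q ≡ j)
      witness = At.even-colour⇒acc i₀ j (proj₂ (proj₂ (frequent N)))

      q : Fin n
      q = proj₁ witness

      q∈t : tAt i₀ q ≡ true
      q∈t = proj₁ (proj₂ witness)

      Ind-q : IndAt i₀ q ≡ j
      Ind-q = proj₂ (proj₂ (proj₂ witness))

      prefix : Path i₀ q
      prefix = reachable i₀ q (inj₂ q∈t)

      run : ℕ → Fin n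
      run = followFrom (proj₁ prefix) i₀ w

      -- The position j of the run can neither drop (that would produce a colour < 2j) nor rise.
      run-position : ∀ l → i₀ ≤ l → tAt l (run l) ≡ true × IndAt l (run l) ≡ j
      run-position = induction-from i₀ base step
        where
        base : tAt i₀ (run i₀) ≡ true × IndAt i₀ (run i₀) ≡ j
        base rewrite followFrom-≤ (proj₁ prefix) i₀ w i₀ ≤-refl | proj₁ (proj₂ (proj₂ prefix)) = q∈t , Ind-q
        step : ∀ l → i₀ ≤ l → tAt l (run l) ≡ true × IndAt l (run l) ≡ j →
               tAt (suc l) (run (suc l)) ≡ true × IndAt (suc l) (run (suc l)) ≡ j
        step l i₀≤l (x∈t , Ix≡j) rewrite followFrom-next (proj₁ prefix) i₀ w l i₀≤l =
          At.next-∈t₂ l (run l) x∈t ,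
          trans (≤-antisym (At.Ind-next-≤ l (run l) x∈t) (≮⇒≥ noDrop)) Ix≡j
          where
          noDrop : ¬ At.Decreases l (run l)
          noDrop dec = <⇒≱ (At.decreases⇒colour-< l (run l) x∈t dec)
                            (subst (λ p → 2 * p ≤ col l) (sym Ix≡j) (colour-≥ l (≤-trans N≤i₀ i₀≤l)))

      isRun : IsRun A w run
      isRun = trans (followFrom-≤ (proj₁ prefix) i₀ w 0 z≤n) (proj₁ (proj₂ prefix)) ,
              followFrom-δ (proj₁ prefix) i₀ w (proj₂ (proj₂ (proj₂ prefix)))

      accepting-at : ∀ i → i₀ ≤ i → col i ≡ 2 * j → α (run i) (w i) (run (suc i)) ≡ true
      accepting-at i i₀≤i coli≡2j with At.even-colour⇒acc i j coli≡2j | run-position i i₀≤i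
      ... | r , r∈t , r-acc , Ir≡j | run∈t , Irun≡j =
        α-resp r≡run (trans (cong (λ z → next z (w i)) r≡run) (sym (followFrom-next (proj₁ prefix) i₀ w i i₀≤i)))
               (At.isAcc⇒α-next i r r∈t r-acc)
        where
        r≡run : r ≡ run i
        r≡run = Position.Ind-injective (WellFormed.order (wfAt i)) r (run i) r∈t run∈t (trans Ir≡j (sym Irun≡j))

      isAccepting : IsAcceptingRun A w run
      isAccepting N′ = let (i , N′⊔i₀≤i , coli≡2j) = frequent (N′ ⊔ i₀) in
        i , ≤-trans (m≤m⊔n N′ i₀) N′⊔i₀≤i ,
        accepting-at i (≤-trans (m≤n⊔m N′ i₀) N′⊔i₀≤i) coli≡2j

      accepted : AcceptsB A w
      accepted = run , isRun , isAccepting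

    AcceptsB⇒AcceptsD : AcceptsB A w → AcceptsD B w
    AcceptsB⇒AcceptsD (ρ , (ρ0 , ρδ) , acc) = Forward.accepted ρ ρ0 ρδ acc

    AcceptsD⇒AcceptsB : AcceptsD B w → AcceptsB A w
    AcceptsD⇒AcceptsB (c , frequent , 2∣c , rarer) =
      let (N , colour-≥) = eventually-≥ col (2 * j) (λ c′ c′<2j → rarer c′ (subst (c′ <_) (sym c≡2j) c′<2j)) in
      Backward.accepted j (subst (FrequentValue col) c≡2j frequent) N colour-≥
      where
      j : ℕ
      j = _∣_.quotient 2∣c
      c≡2j : c ≡ 2 * j
      c≡2j = trans (_∣_.equality 2∣c) (*-comm j 2)

mainTheorem3 : ExcludedMiddle 0ℓ →
    ∀ {n k : ℕ} (A : Buchi n k) (Qd : Subset n) (Ord : Fin n → ℕ∞) →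
    IsBuchi A → IsLimitDet A Qd → IsOrdering Qd Ord →
    ∀ (w : Word k) → AcceptsB A w ⇔ AcceptsD (Construction.B A Qd Ord) w
mainTheorem3 em A Qd Ord isB isLD isO w = mk⇔ AcceptsB⇒AcceptsD AcceptsD⇒AcceptsB
  where
  open Correctness A Qd Ord isB isLD isO
  open Run em w
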